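{- Let $r\ge 2$, let $k_1,\dots,k_r$ be integers with $k_i\ge 1$ for $i=1,\dots,r-1$, $k_r\ge 2$ and $k_1+\cdots+k_r=n$. Let $M_1=x_1\cdots x_{k_1}$, $M_2=x_{k_1+1}\cdots x_{k_1+k_2}$, $\dots$, $M_r=x_{k_1+\cdots+k_{r-1}+1}\cdots x_n$ over $\mathbb{F}_2$, and let $$f_r(x_1,\dots,x_n)=M_1(M_2(\cdots(M_{r-1}(M_r\oplus 1)\oplus 1)\cdots)\oplus 1).$$ Then $$C_0(f_r)=\begin{cases}k_2+k_4+\cdots+k_{r-1}+1, & r \text{ odd},\\ k_2+k_4+\cdots+k_r, & r\text{ even},\end{cases}\qquad C_1(f_r)=\begin{cases}k_1+k_3+\cdots+k_r, & r\text{ odd},\\ k_1+k_3+\cdots+k_{r-1}+1, & r\text{ even}.\end{cases}$$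
   Context: $\oplus$ denotes addition modulo 2. For a Boolean function $f$ on $\mathbb{F}_2^n$ and a word $\alpha=(a_1,\dots,a_n)\in\mathbb{F}_2^n$, a subset $\{i_1,\dots,i_k\}\subseteq\{1,\dots,n\}$ is a certificate of $f$ on $\alpha$ if the restriction of $f$ obtained by setting $x_{i_1}=a_{i_1},\dots,x_{i_k}=a_{i_k}$ is a constant function. $C(f,\alpha)$ is the smallest cardinality of a certificate of $f$ on $\alpha$; for $b\in\mathbb{F}_2$, the $b$-certificate complexity is $C_b(f)=\max\{C(f,y): y\in\mathbb{F}_2^n,\ f(y)=b\}$. -}

module Defs where

open import Data.Bool using (Bool; true; false; _∧_; not)
open import Data.Nat using (ℕ; zero; suc; _+_; _≤_)
open import Data.List using (List; []; _∷_)
open import Data.Vec using (Vec; lookup; take; drop)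
open import Data.Fin using (Fin)
open import Data.Fin.Subset using (Subset; _∈_; ∣_∣)
open import Data.Product using (Σ; _×_; _,_)
open import Relation.Binary.PropositionalEquality using (_≡_)

-- Boolean functions on F₂ⁿ (F₂ = Bool, ⊕ = xor, product = ∧)
BoolFun : ℕ → Set
BoolFun n = Vec Bool n → Bool

IsCertificate : ∀ {n} → BoolFun n → Vec Bool n → Subset n → Set
IsCertificate {n} f α S =
  Σ Bool λ b → (y : Vec Bool n) →
    ((i : Fin n) → i ∈ S → lookup y i ≡ lookup α i) → f y ≡ b

IsCertComplexityAt : ∀ {n} → BoolFun n → Vec Bool n → ℕ → Set
IsCertComplexityAt {n} f α m =
  (Σ (Subset n) λ S → IsCertificate f α S × ∣ S ∣ ≡ m)
  × ((S : Subset n) → IsCertificate f α S → m ≤ ∣ S ∣)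

IsBCertComplexity : ∀ {n} → BoolFun n → Bool → ℕ → Set
IsBCertComplexity {n} f b m =
  (Σ (Vec Bool n) λ y → f y ≡ b × IsCertComplexityAt f y m)
  × ((y : Vec Bool n) (c : ℕ) → f y ≡ b → IsCertComplexityAt f y c → c ≤ m)

blocksum : List ℕ → ℕ
blocksum [] = 0
blocksum (k ∷ ks) = k + blocksum ks

monomial : ∀ {k} → Vec Bool k → Bool
monomial Data.Vec.[] = true
monomial (x Data.Vec.∷ xs) = x ∧ monomial xs

-- g for blocks k₁,…,k_r :  g = M₁ (g' ⊕ 1) where g' is the function of the
-- remaining blocks, and for a single block g = M_r.
-- Thus g(k₁,…,k_r) = M₁(M₂(⋯(M_{r-1}(M_r ⊕ 1) ⊕ 1)⋯) ⊕ 1) = f_r.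
nested : (ks : List ℕ) → BoolFun (blocksum ks)
nested [] x = true
nested (k ∷ []) x = monomial (take k x)
nested (k ∷ k' ∷ ks) x = monomial (take k x) ∧ not (nested (k' ∷ ks) (drop k x))

oddSum evenSum : List ℕ → ℕ
oddSum [] = 0
oddSum (k ∷ ks) = k + evenSum ks
evenSum [] = 0
evenSum (k ∷ ks) = oddSum ks

-- f_r = M₁ ∧ ¬ g, where g is the function of the blocks k₂,…,k_r and depends on
-- variables disjoint from those of M₁. For a conjunction of functions on disjoint
-- variables the 1-certificate complexities add, while the 0-certificate complexity is
-- at most the larger of the two and is attained by either factor against a 1-input of
-- the other; negation swaps C₀ and C₁; and a monomial of degree k has C₀ = 1, C₁ = k.
-- Hence C₀(f) = max(1, C₁(g)) = C₁(g) and C₁(f) = k₁ + C₀(g), and unwinding this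
-- recursion yields the alternating sums.
module Submission where

open import Defs
open import Data.Bool using (Bool; true; false; _∧_; not)
open import Data.Bool.Properties using (∧-identityʳ; ∧-zeroʳ; ∧-conicalˡ; ∧-conicalʳ; not-injective)
open import Data.Fin using (Fin; zero; suc)
open import Data.Fin.Subset using (Subset; _∈_; ∣_∣; inside; outside; ⊤; ⁅_⁆) renaming (⊥ to ∅)
open import Data.Fin.Subset.Properties using (∣⊥∣≡0; ∣⊤∣≡n; ∣⁅x⁆∣≡1)
open import Data.List using (List; []; _∷_; _++_; [_]; length)
open import Data.List.Relation.Unary.All using (All; []; _∷_)
open import Data.List.Relation.Unary.All.Properties using (++⁺)
open import Data.Nat using (ℕ; zero; suc; _+_; _⊔_; _≤_; _%_; z≤n)
open import Data.Nat.Properties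
  using (≤-trans; ≤-reflexive; ≤-antisym; +-mono-≤; m≤m+n; m≤n+m; m≤m⊔n; m≤n⊔m;
         m≤n⇒m⊔n≡n; n≢0⇒n>0; <⇒≤; +-identityʳ; +-assoc)
open import Data.Product using (_×_; _,_; proj₁; proj₂; ∃-syntax; map; map₁; map₂)
open import Data.Vec using (Vec; []; _∷_; take; drop; lookup; replicate)
  renaming (_++_ to _++ᵛ_)
open import Data.Vec.Base using (here; there)
open import Data.Vec.Properties using (take++drop≡id)
open import Function using (_∘_; const; case_of_)
open import Relation.Binary.PropositionalEquality
  using (_≡_; _≢_; _≗_; refl; sym; trans; cong; cong₂; subst; module ≡-Reasoning)

private
  variable
    m n k a c c₀ c₁ : ℕ
    b : Bool

-- The hypothesis of IsCertificate, stated structurally so that it splits along _++_.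
data Agree : Subset n → Vec Bool n → Vec Bool n → Set where
  []       : Agree [] [] []
  inside∷  : ∀ {S : Subset n} {z x} {a : Bool} → Agree S z x → Agree (inside ∷ S) (a ∷ z) (a ∷ x)
  outside∷ : ∀ {S : Subset n} {z x} {a a′ : Bool} → Agree S z x → Agree (outside ∷ S) (a ∷ z) (a′ ∷ x)

agree-refl : (S : Subset n) (x : Vec Bool n) → Agree S x x
agree-refl []            []      = []
agree-refl (inside ∷ S)  (a ∷ x) = inside∷ (agree-refl S x)
agree-refl (outside ∷ S) (a ∷ x) = outside∷ (agree-refl S x)

agree-⊤ : {z x : Vec Bool n} → Agree ⊤ z x → z ≡ x
agree-⊤ []              = refl
agree-⊤ (inside∷ agree) = cong (_ ∷_) (agree-⊤ agree)

∣S∣≡0⇒agree : (S : Subset n) (z x : Vec Bool n) → ∣ S ∣ ≡ 0 → Agree S z x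
∣S∣≡0⇒agree []            []      []      _       = []
∣S∣≡0⇒agree (outside ∷ S) (a ∷ z) (_ ∷ x) ∣S∣≡0 = outside∷ (∣S∣≡0⇒agree S z x ∣S∣≡0)

agree-++⁻ : (T : Subset m) {U : Subset n} {z x : Vec Bool (m + n)} →
            Agree (T ++ᵛ U) z x →
            Agree T (take m z) (take m x) × Agree U (drop m z) (drop m x)
agree-++⁻ []                                    agree              = [] , agree
agree-++⁻ (inside ∷ T)  {z = _ ∷ z} {x = _ ∷ x} (inside∷ agree)  = map₁ inside∷ (agree-++⁻ T agree)
agree-++⁻ (outside ∷ T) {z = _ ∷ z} {x = _ ∷ x} (outside∷ agree) = map₁ outside∷ (agree-++⁻ T agree)

agree-++⁺ : (S : Subset (m + n)) {u u′ : Vec Bool m} {v v′ : Vec Bool n} →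
            Agree (take m S) u u′ → Agree (drop m S) v v′ → Agree S (u ++ᵛ v) (u′ ++ᵛ v′)
agree-++⁺ {zero}  S             []               agreeD = agreeD
agree-++⁺ {suc m} (inside ∷ S)  (inside∷ agreeT)  agreeD = inside∷ (agree-++⁺ S agreeT agreeD)
agree-++⁺ {suc m} (outside ∷ S) (outside∷ agreeT) agreeD = outside∷ (agree-++⁺ S agreeT agreeD)

agree⇒lookup : {S : Subset n} {z x : Vec Bool n} →
               Agree S z x → (i : Fin n) → i ∈ S → lookup z i ≡ lookup x i
agree⇒lookup (inside∷ agree)  zero    here      = refl
agree⇒lookup (inside∷ agree)  (suc i) (there p) = agree⇒lookup agree i p
agree⇒lookup (outside∷ agree) (suc i) (there p) = agree⇒lookup agree i p

lookup⇒agree : (S : Subset n) (z x : Vec Bool n) →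
               ((i : Fin n) → i ∈ S → lookup z i ≡ lookup x i) → Agree S z x
lookup⇒agree []            []      []      _     = []
lookup⇒agree (inside ∷ S)  (a ∷ z) (a′ ∷ x) equal with equal zero here
... | refl = inside∷ (lookup⇒agree S z x (λ i p → equal (suc i) (there p)))
lookup⇒agree (outside ∷ S) (a ∷ z) (a′ ∷ x) equal =
  outside∷ (lookup⇒agree S z x (λ i p → equal (suc i) (there p)))

∣++∣ : (T : Subset m) (U : Subset n) → ∣ T ++ᵛ U ∣ ≡ ∣ T ∣ + ∣ U ∣
∣++∣ []            U = refl
∣++∣ (inside ∷ T)  U = cong suc (∣++∣ T U)
∣++∣ (outside ∷ T) U = ∣++∣ T U

∣++∅∣ : (T : Subset m) → ∣ T ++ᵛ ∅ {n} ∣ ≡ ∣ T ∣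
∣++∅∣ {n = n} T = trans (∣++∣ T ∅) (trans (cong (∣ T ∣ +_) (∣⊥∣≡0 n)) (+-identityʳ _))

∣∅++∣ : ∀ m (U : Subset n) → ∣ ∅ {m} ++ᵛ U ∣ ≡ ∣ U ∣
∣∅++∣ zero    U = refl
∣∅++∣ (suc m) U = ∣∅++∣ m U

∣take∣+∣drop∣ : ∀ m (S : Subset (m + n)) → ∣ take m S ∣ + ∣ drop m S ∣ ≡ ∣ S ∣
∣take∣+∣drop∣ m S = trans (sym (∣++∣ (take m S) (drop m S))) (cong ∣_∣ (take++drop≡id m S))

Certifies : BoolFun n → Vec Bool n → Subset n → Set
Certifies {n} f x S = (z : Vec Bool n) → Agree S z x → f z ≡ f x

CertComplexity≤ : BoolFun n → Bool → ℕ → Set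
CertComplexity≤ {n} f b c =
  (x : Vec Bool n) → f x ≡ b → ∃[ S ] Certifies f x S × ∣ S ∣ ≤ c

CertComplexity≥ : BoolFun n → Bool → ℕ → Set
CertComplexity≥ {n} f b c =
  ∃[ x ] f x ≡ b × ((S : Subset n) → Certifies f x S → c ≤ ∣ S ∣)

CertComplexity : BoolFun n → Bool → ℕ → Set
CertComplexity f b c = CertComplexity≤ f b c × CertComplexity≥ f b c

module _ {f : BoolFun n} {x : Vec Bool n} {S : Subset n} where

  certifies⇒isCertificate : Certifies f x S → IsCertificate f x S
  certifies⇒isCertificate cert = f x , λ z equal → cert z (lookup⇒agree S z x equal)

  isCertificate⇒certifies : IsCertificate f x S → Certifies f x S
  isCertificate⇒certifies (_ , constant) z agree =
    trans (constant z (agree⇒lookup agree)) (sym (constant x (λ _ _ → refl)))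

certComplexity⇒isBCertComplexity : {f : BoolFun n} →
  CertComplexity f b c → IsBCertComplexity f b c
certComplexity⇒isBCertComplexity (upper , x , fx≡b , lower)
  with upper x fx≡b
... | S , cert , ∣S∣≤c =
  (x , fx≡b , (S , certifies⇒isCertificate cert , ≤-antisym ∣S∣≤c (lower S cert)) ,
     λ S′ cert′ → lower S′ (isCertificate⇒certifies cert′)) ,
  λ { y c′ fy≡b (_ , minimal) →
        let (S , cert , ∣S∣≤c) = upper y fy≡b
        in  ≤-trans (minimal S (certifies⇒isCertificate cert)) ∣S∣≤c }

nonconstant⇒certComplexity≥1 : {f : BoolFun n} {x y : Vec Bool n} →
  f x ≡ b → f y ≢ b → CertComplexity≥ f b 1
nonconstant⇒certComplexity≥1 {x = x} {y} fx≡b fy≢b =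
  x , fx≡b , λ S cert → n≢0⇒n>0 λ ∣S∣≡0 →
    fy≢b (trans (cert y (∣S∣≡0⇒agree S y x ∣S∣≡0)) fx≡b)

certifies-≗ : {f g : BoolFun n} {x : Vec Bool n} {S : Subset n} →
  f ≗ g → Certifies f x S → Certifies g x S
certifies-≗ {x = x} f≗g cert z agree = trans (sym (f≗g z)) (trans (cert z agree) (f≗g x))

certComplexity-≗ : {f g : BoolFun n} → f ≗ g → CertComplexity f b c → CertComplexity g b c
certComplexity-≗ f≗g (upper , x , fx≡b , lower) =
  (λ y gy≡b → let (S , cert , ∣S∣≤c) = upper y (trans (f≗g y) gy≡b)
              in  S , certifies-≗ f≗g cert , ∣S∣≤c) ,
  x , trans (sym (f≗g x)) fx≡b , λ S cert → lower S (certifies-≗ (sym ∘ f≗g) cert)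

certComplexity-not : {f : BoolFun n} → CertComplexity f b c → CertComplexity (not ∘ f) (not b) c
certComplexity-not (upper , x , fx≡b , lower) =
  (λ y ¬fy≡¬b → let (S , cert , ∣S∣≤c) = upper y (not-injective ¬fy≡¬b)
                in  S , (λ z agree → cong not (cert z agree)) , ∣S∣≤c) ,
  x , cong not fx≡b , λ S cert → lower S (λ z agree → not-injective (cert z agree))

take-++ : {A : Set} (u : Vec A m) (v : Vec A n) → take m (u ++ᵛ v) ≡ u
take-++ []      v = refl
take-++ (a ∷ u) v = cong (a ∷_) (take-++ u v)

drop-++ : {A : Set} (u : Vec A m) (v : Vec A n) → drop m (u ++ᵛ v) ≡ v
drop-++ []      v = refl
drop-++ (a ∷ u) v = drop-++ u v

infixr 6 _⊗_

_⊗_ : BoolFun m → BoolFun n → BoolFun (m + n)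
_⊗_ {m} h g x = h (take m x) ∧ g (drop m x)

module _ (h : BoolFun m) (g : BoolFun n) where

  ⊗-++ : (u : Vec Bool m) (v : Vec Bool n) → (h ⊗ g) (u ++ᵛ v) ≡ h u ∧ g v
  ⊗-++ u v = cong₂ _∧_ (cong h (take-++ u v)) (cong g (drop-++ u v))

  module _ {x : Vec Bool (m + n)} {T : Subset m} {U : Subset n} where

    certifies-⊗ : Certifies h (take m x) T → Certifies g (drop m x) U →
                  Certifies (h ⊗ g) x (T ++ᵛ U)
    certifies-⊗ certT certU z agree =
      let (agreeT , agreeU) = agree-++⁻ T agree
      in  cong₂ _∧_ (certT (take m z) agreeT) (certU (drop m z) agreeU)

    certifies-⊗ˡ : h (take m x) ≡ false → Certifies h (take m x) T →
                   Certifies (h ⊗ g) x (T ++ᵛ U)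
    certifies-⊗ˡ hx≡false certT z agree =
      trans (∧-falseˡ (trans (certT (take m z) (proj₁ (agree-++⁻ T agree))) hx≡false))
            (sym (∧-falseˡ hx≡false))
      where
      ∧-falseˡ : ∀ {p q} → p ≡ false → p ∧ q ≡ false
      ∧-falseˡ refl = refl

    certifies-⊗ʳ : g (drop m x) ≡ false → Certifies g (drop m x) U →
                   Certifies (h ⊗ g) x (T ++ᵛ U)
    certifies-⊗ʳ gx≡false certU z agree =
      trans (∧-falseʳ (trans (certU (drop m z) (proj₂ (agree-++⁻ T agree))) gx≡false))
            (sym (∧-falseʳ gx≡false))
      where
      ∧-falseʳ : ∀ {p q} → q ≡ false → p ∧ q ≡ false
      ∧-falseʳ {p} refl = ∧-zeroʳ p

  module _ {u : Vec Bool m} {v : Vec Bool n} {S : Subset (m + n)} where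

    certifies-⊗⁻ˡ : g v ≡ true → Certifies (h ⊗ g) (u ++ᵛ v) S → Certifies h u (take m S)
    certifies-⊗⁻ˡ gv≡true cert w agree = begin
      h w                  ≡⟨ ∧-identityʳ (h w) ⟨
      h w ∧ true           ≡⟨ cong (h w ∧_) gv≡true ⟨
      h w ∧ g v            ≡⟨ ⊗-++ w v ⟨
      (h ⊗ g) (w ++ᵛ v)    ≡⟨ cert (w ++ᵛ v) (agree-++⁺ S agree (agree-refl (drop m S) v)) ⟩
      (h ⊗ g) (u ++ᵛ v)    ≡⟨ ⊗-++ u v ⟩
      h u ∧ g v            ≡⟨ cong (h u ∧_) gv≡true ⟩
      h u ∧ true           ≡⟨ ∧-identityʳ (h u) ⟩
      h u                  ∎
      where open ≡-Reasoning

    certifies-⊗⁻ʳ : h u ≡ true → Certifies (h ⊗ g) (u ++ᵛ v) S → Certifies g v (drop m S)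
    certifies-⊗⁻ʳ hu≡true cert w agree = begin
      g w                  ≡⟨ cong (_∧ g w) hu≡true ⟨
      h u ∧ g w            ≡⟨ ⊗-++ u w ⟨
      (h ⊗ g) (u ++ᵛ w)    ≡⟨ cert (u ++ᵛ w) (agree-++⁺ S (agree-refl (take m S) u) agree) ⟩
      (h ⊗ g) (u ++ᵛ v)    ≡⟨ ⊗-++ u v ⟩
      h u ∧ g v            ≡⟨ cong (_∧ g v) hu≡true ⟩
      g v                  ∎
      where open ≡-Reasoning

module _ {h : BoolFun m} {g : BoolFun n} where

  ⊗-certComplexity≤-true : CertComplexity≤ h true a → CertComplexity≤ g true c →
                           CertComplexity≤ (h ⊗ g) true (a + c)
  ⊗-certComplexity≤-true upperh upperg x hx∧gx≡true =
    let (T , certT , ∣T∣≤a) = upperh (take m x) (∧-conicalˡ _ _ hx∧gx≡true)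
        (U , certU , ∣U∣≤c) = upperg (drop m x) (∧-conicalʳ _ _ hx∧gx≡true)
    in  T ++ᵛ U , certifies-⊗ h g certT certU ,
        ≤-trans (≤-reflexive (∣++∣ T U)) (+-mono-≤ ∣T∣≤a ∣U∣≤c)

  ⊗-certComplexity≤-false : CertComplexity≤ h false a → CertComplexity≤ g false c →
                            CertComplexity≤ (h ⊗ g) false (a ⊔ c)
  ⊗-certComplexity≤-false {a} {c} upperh upperg x hx∧gx≡false = byFirstFactor _ refl
    where
    byFirstFactor : (p : Bool) → h (take m x) ≡ p →
                    ∃[ S ] Certifies (h ⊗ g) x S × ∣ S ∣ ≤ a ⊔ c
    byFirstFactor false hx≡false =
      let (T , certT , ∣T∣≤a) = upperh (take m x) hx≡false
      in  T ++ᵛ ∅ , certifies-⊗ˡ h g hx≡false certT ,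
          ≤-trans (≤-reflexive (∣++∅∣ T)) (≤-trans ∣T∣≤a (m≤m⊔n a c))
    byFirstFactor true hx≡true =
      let gx≡false = trans (sym (cong (_∧ _) hx≡true)) hx∧gx≡false
          (U , certU , ∣U∣≤c) = upperg (drop m x) gx≡false
      in  ∅ {m} ++ᵛ U , certifies-⊗ʳ h g gx≡false certU ,
          ≤-trans (≤-reflexive (∣∅++∣ m U)) (≤-trans ∣U∣≤c (m≤n⊔m a c))

  ⊗-certComplexity≥-true : CertComplexity≥ h true a → CertComplexity≥ g true c →
                           CertComplexity≥ (h ⊗ g) true (a + c)
  ⊗-certComplexity≥-true (u , hu≡true , lowerh) (v , gv≡true , lowerg) =
    u ++ᵛ v , trans (⊗-++ h g u v) (cong₂ _∧_ hu≡true gv≡true) ,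
    λ S cert → ≤-trans (+-mono-≤ (lowerh (take m S) (certifies-⊗⁻ˡ h g gv≡true cert))
                                 (lowerg (drop m S) (certifies-⊗⁻ʳ h g hu≡true cert)))
                       (≤-reflexive (∣take∣+∣drop∣ m S))

  ⊗-certComplexity≥-falseˡ : {v : Vec Bool n} → CertComplexity≥ h false a → g v ≡ true →
                             CertComplexity≥ (h ⊗ g) false a
  ⊗-certComplexity≥-falseˡ {v = v} (u , hu≡false , lowerh) gv≡true =
    u ++ᵛ v , trans (⊗-++ h g u v) (cong₂ _∧_ hu≡false gv≡true) ,
    λ S cert → ≤-trans (lowerh (take m S) (certifies-⊗⁻ˡ h g gv≡true cert))
                       (≤-trans (m≤m+n _ _) (≤-reflexive (∣take∣+∣drop∣ m S)))

  ⊗-certComplexity≥-falseʳ : {u : Vec Bool m} → h u ≡ true → CertComplexity≥ g false c →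
                             CertComplexity≥ (h ⊗ g) false c
  ⊗-certComplexity≥-falseʳ {u = u} hu≡true (v , gv≡false , lowerg) =
    u ++ᵛ v , trans (⊗-++ h g u v) (cong₂ _∧_ hu≡true gv≡false) ,
    λ S cert → ≤-trans (lowerg (drop m S) (certifies-⊗⁻ʳ h g hu≡true cert))
                       (≤-trans (m≤n+m _ _) (≤-reflexive (∣take∣+∣drop∣ m S)))

monomial-ones : ∀ k → monomial (replicate k true) ≡ true
monomial-ones zero    = refl
monomial-ones (suc k) = monomial-ones k

certifies-monomial-ones⇒⊤ : (S : Subset k) → Certifies monomial (replicate k true) S → S ≡ ⊤
certifies-monomial-ones⇒⊤ []            cert = refl
certifies-monomial-ones⇒⊤ {suc k} (outside ∷ S) cert
  with trans (cert (false ∷ replicate k true) (outside∷ (agree-refl S _))) (monomial-ones k)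
... | ()
certifies-monomial-ones⇒⊤ (inside ∷ S)  cert =
  cong (inside ∷_) (certifies-monomial-ones⇒⊤ S (λ z agree → cert (true ∷ z) (inside∷ agree)))

monomial-certComplexity≤-true : CertComplexity≤ (monomial {k}) true k
monomial-certComplexity≤-true {k} x _ =
  ⊤ , (λ z agree → cong monomial (agree-⊤ agree)) , ≤-reflexive (∣⊤∣≡n k)

monomial-certComplexity≥-true : CertComplexity≥ (monomial {k}) true k
monomial-certComplexity≥-true {k} =
  replicate k true , monomial-ones k ,
  λ S cert → ≤-reflexive (trans (sym (∣⊤∣≡n k)) (cong ∣_∣ (sym (certifies-monomial-ones⇒⊤ S cert))))

monomial-certComplexity≤-false : CertComplexity≤ (monomial {k}) false 1
monomial-certComplexity≤-false {suc k} (false ∷ x) _ =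
  ⁅ zero ⁆ , (λ { (_ ∷ z) (inside∷ _) → refl }) , ≤-reflexive (∣⁅x⁆∣≡1 {n = suc k} zero)
monomial-certComplexity≤-false (true ∷ x) mx≡false =
  let (S , cert , ∣S∣≤1) = monomial-certComplexity≤-false x mx≡false
  in  outside ∷ S , certifies-outside cert , ∣S∣≤1
  where
  certifies-outside : ∀ {S} → Certifies monomial x S → Certifies monomial (true ∷ x) (outside ∷ S)
  certifies-outside cert (false ∷ z) _                = sym mx≡false
  certifies-outside cert (true ∷ z)  (outside∷ agree) = cert z agree

monomial-certComplexity≥-false : CertComplexity≥ (monomial {suc k}) false 1
monomial-certComplexity≥-false {k} =
  nonconstant⇒certComplexity≥1 {x = false ∷ replicate k true} {y = replicate (suc k) true} refl
    (λ ones≡false → case trans (sym (monomial-ones (suc k))) ones≡false of λ ())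

monomial⊗not-certComplexity : ∀ k {g : BoolFun n} → 1 ≤ c₁ →
  CertComplexity g false c₀ → CertComplexity g true c₁ →
  CertComplexity (monomial {k} ⊗ (not ∘ g)) false c₁ ×
  CertComplexity (monomial {k} ⊗ (not ∘ g)) true (k + c₀)
monomial⊗not-certComplexity k {g} 1≤c₁ C₀ C₁ =
  (subst (CertComplexity≤ (monomial ⊗ (not ∘ g)) false) (m≤n⇒m⊔n≡n 1≤c₁)
     (⊗-certComplexity≤-false {h = monomial} monomial-certComplexity≤-false (proj₁ ¬C₀)) ,
   ⊗-certComplexity≥-falseʳ {h = monomial} {u = replicate k true} (monomial-ones k) (proj₂ ¬C₀)) ,
  (⊗-certComplexity≤-true {h = monomial} monomial-certComplexity≤-true (proj₁ ¬C₁) ,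
   ⊗-certComplexity≥-true {h = monomial} monomial-certComplexity≥-true (proj₂ ¬C₁))
  where
  ¬C₀ = certComplexity-not C₁
  ¬C₁ = certComplexity-not C₀

single-block-certComplexity : ∀ k → 1 ≤ k →
  CertComplexity (nested (k ∷ [])) false 1 × CertComplexity (nested (k ∷ [])) true (k + 0)
single-block-certComplexity (suc k) _ =
  certComplexity-≗ monomial⊗true≗nested
    ( ⊗-certComplexity≤-false {h = monomial} {g = true₀} {c = 0} monomial-certComplexity≤-false (λ _ ())
    , ⊗-certComplexity≥-falseˡ {h = monomial} {g = true₀} {v = []} monomial-certComplexity≥-false refl) ,
  certComplexity-≗ monomial⊗true≗nested
    ( ⊗-certComplexity≤-true {h = monomial} {g = true₀} monomial-certComplexity≤-true
        (λ _ _ → [] , (λ _ _ → refl) , z≤n)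
    , ⊗-certComplexity≥-true {h = monomial} {g = true₀} monomial-certComplexity≥-true
        ([] , refl , λ _ _ → z≤n))
  where
  true₀ : BoolFun 0
  true₀ = const true
  monomial⊗true≗nested : monomial ⊗ true₀ ≗ nested (suc k ∷ [])
  monomial⊗true≗nested x = ∧-identityʳ _

NestedCertComplexity : List ℕ → Set
NestedCertComplexity ks =
  CertComplexity (nested ks) false (evenSum ks + length ks % 2) ×
  CertComplexity (nested ks) true (oddSum ks + suc (length ks) % 2)

nested-certComplexity : ∀ k ks → All (1 ≤_) (k ∷ ks) → NestedCertComplexity (k ∷ ks)
nested-certComplexity k [] (1≤k ∷ []) =
  map₂ (subst (CertComplexity _ true) (sym (+-identityʳ (k + 0))))
       (single-block-certComplexity k 1≤k)
nested-certComplexity k (k′ ∷ ks) (_ ∷ 1≤ks@(1≤k′ ∷ _)) =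
  let (C₀ , C₁) = nested-certComplexity k′ ks 1≤ks
  in  map₂ (subst (CertComplexity _ true) (sym (+-assoc k (evenSum (k′ ∷ ks)) _)))
           (monomial⊗not-certComplexity k 1≤c₁ C₀ C₁)
  where
  1≤c₁ : 1 ≤ oddSum (k′ ∷ ks) + suc (length (k′ ∷ ks)) % 2
  1≤c₁ = ≤-trans 1≤k′ (≤-trans (m≤m+n k′ _) (m≤m+n _ _))

snoc-certComplexity : ∀ ks kr → All (1 ≤_) (ks ++ [ kr ]) → NestedCertComplexity (ks ++ [ kr ])
snoc-certComplexity []       kr = nested-certComplexity kr []
snoc-certComplexity (k ∷ ks) kr = nested-certComplexity k (ks ++ [ kr ])

parity-cases : ∀ m {P : ℕ → ℕ → Set} → P (m % 2) (suc m % 2) →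
               (m % 2 ≡ 1 → P 1 0) × (m % 2 ≡ 0 → P 0 1)
parity-cases zero          p = (λ ()) , (λ _ → p)
parity-cases (suc zero)    p = (λ _ → p) , (λ ())
parity-cases (suc (suc m)) {P} p = parity-cases m {P} p

-- The hypotheses 2 ≤ r and 2 ≤ kr are stronger than needed: r ≥ 1 and kr ≥ 1 suffice.
theorem3p7 : (r : ℕ) (ks : List ℕ) (kr : ℕ) →
    2 ≤ r → length (ks ++ [ kr ]) ≡ r → All (1 ≤_) ks → 2 ≤ kr →
    ((r % 2 ≡ 1) →
       IsBCertComplexity (nested (ks ++ [ kr ])) false (evenSum (ks ++ [ kr ]) + 1)
       × IsBCertComplexity (nested (ks ++ [ kr ])) true (oddSum (ks ++ [ kr ])))
    × ((r % 2 ≡ 0) →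
       IsBCertComplexity (nested (ks ++ [ kr ])) false (evenSum (ks ++ [ kr ]))
       × IsBCertComplexity (nested (ks ++ [ kr ])) true (oddSum (ks ++ [ kr ]) + 1))
theorem3p7 r ks kr _ refl 1≤ks 2≤kr =
  map (λ odd r%2≡1 → map₂ (subst (IsBCertComplexity (nested L) true) (+-identityʳ _)) (odd r%2≡1))
      (λ even r%2≡0 → map₁ (subst (IsBCertComplexity (nested L) false) (+-identityʳ _)) (even r%2≡0))
      (parity-cases (length L) {P}
        (map certComplexity⇒isBCertComplexity certComplexity⇒isBCertComplexity
             (snoc-certComplexity ks kr (++⁺ 1≤ks (<⇒≤ 2≤kr ∷ [])))))
  where
  L = ks ++ [ kr ]
  P : ℕ → ℕ → Set
  P p q = IsBCertComplexity (nested L) false (evenSum L + p) ×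
          IsBCertComplexity (nested L) true (oddSum L + q)
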